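{- For every core $C$, $|N(H(C))|\le \ell$.
   Context: Let $G=(V,E)$ be a finite undirected graph, $T\subseteq V$ a set of terminals and $\ell\ge 0$ an integer. Standing assumptions: $T$ is $\ell$-connected in $G$ (every pair of distinct terminals is joined by $\ell$ openly disjoint paths, i.e. paths sharing only their endpoints), $|T|\ge 2\ell$, and no two terminals are adjacent in $G$. For $U\subseteq V$, let $N(U)=\{v\in V\setminus U:\exists u\in U,\ uv\in E\}$ and $U^*=V\setminus(U\cup N(U))$. A deficient set is a set $U\subseteq V$ with $U\cap T\ne\emptyset$, $U^*\cap T\neq\emptyset$ and $|N(U)|<\ell+1$. A deficient set $U$ is small if $|U\cap T|\le |U^*\cap T|$. A core is an inclusionwise minimal small deficient set. For a core $C$, $\mathrm{Halo}(C)$ is the family of all small deficient sets $U$ with $C\subseteq U$ such that no core $D\ne C$ satisfies $D\subseteq U$, and the halo-set $H(C)$ is the union of all sets in $\mathrm{Halo}(C)$. -}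

module Defs where

open import Data.Nat using (ℕ; zero; suc; _+_; _*_; _≤_; _<_)
open import Data.Bool using (Bool; true; false; _∧_; _∨_; not)
open import Data.Fin using (Fin)
open import Data.Fin.Subset using (Subset; _∈_; _⊆_; _∩_; _∪_; ∁; ∣_∣; Nonempty)
open import Data.Vec using (Vec; tabulate; lookup)
open import Data.List using (List; []; _∷_; _++_)
import Data.List.Membership.Propositional as L
open import Data.List.Relation.Unary.Unique.Propositional using (Unique)
open import Data.Product using (Σ; ∃; ∃-syntax; _×_; _,_)
open import Relation.Binary.PropositionalEquality using (_≡_; _≢_)
open import Relation.Nullary using (¬_)
open import Function.Bundles using (_⇔_)

record Graph (n : ℕ) : Set where
  field
    adj    : Fin n → Fin n → Bool
    sym    : ∀ u v → adj u v ≡ adj v u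
    irrefl : ∀ v → adj v v ≡ false
open Graph public

anyFin : {n : ℕ} → (Fin n → Bool) → Bool
anyFin {zero}  f = false
anyFin {suc n} f = f Fin.zero ∨ anyFin (λ i → f (Fin.suc i))

module _ {n : ℕ} (G : Graph n) where

  N : Subset n → Subset n
  N U = tabulate λ v → not (lookup U v) ∧ anyFin (λ u → lookup U u ∧ adj G u v)

  _* : Subset n → Subset n
  U * = ∁ (U ∪ N U)

  data Chain : List (Fin n) → Set where
    chain-[] : Chain []
    chain-1  : ∀ v → Chain (v ∷ [])
    chain-∷  : ∀ u v vs → adj G u v ≡ true → Chain (v ∷ vs) → Chain (u ∷ v ∷ vs)

  record Path (s t : Fin n) : Set where
    field
      inner  : List (Fin n)
      chain  : Chain (s ∷ inner ++ t ∷ [])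
      unique : Unique (s ∷ inner ++ t ∷ [])
  open Path public

  DisjointList : List (Fin n) → List (Fin n) → Set
  DisjointList xs ys = ∀ v → v L.∈ xs → v L.∈ ys → ⊥′
    where open import Data.Empty renaming (⊥ to ⊥′)

  OpenlyDisjointPaths : ℕ → Fin n → Fin n → Set
  OpenlyDisjointPaths k s t =
    Σ (Vec (Path s t) k) λ ps →
      ∀ i j → i ≢ j → DisjointList (inner (lookup ps i)) (inner (lookup ps j))

  Connected : Subset n → ℕ → Set
  Connected T ℓ = ∀ s t → s ∈ T → t ∈ T → s ≢ t → OpenlyDisjointPaths ℓ s t

  module _ (T : Subset n) (ℓ : ℕ) where

    Deficient : Subset n → Set
    Deficient U = Nonempty (U ∩ T) × Nonempty ((U *) ∩ T) × ∣ N U ∣ < ℓ + 1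

    Small : Subset n → Set
    Small U = Deficient U × ∣ U ∩ T ∣ ≤ ∣ (U *) ∩ T ∣

    Core : Subset n → Set
    Core C = Small C × (∀ U → Small U → U ⊆ C → U ≡ C)

    InHalo : Subset n → Subset n → Set
    InHalo C U = Small U × C ⊆ U × (∀ D → Core D → D ⊆ U → D ≡ C)

    IsHaloSet : Subset n → Subset n → Set
    IsHaloSet C H = ∀ v → (v ∈ H) ⇔ (∃[ U ] (InHalo C U × v ∈ U))

-- A halo member U is a deficient superset of the core C: it contains a terminal s ∈ C, misses a
-- terminal t ∈ U*, and |N(U)| ≤ ℓ. For any W ⊇ C with |N(W)| ≤ ℓ, the set U ∩ W still separates
-- s from t, so Menger's easy direction gives |N(U ∩ W)| ≥ ℓ, and
-- submodularity |N(U ∩ W)| + |N(U ∪ W)| ≤ |N(U)| + |N(W)| ≤ 2ℓ leaves |N(U ∪ W)| ≤ ℓ.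
-- Adding the halo members one at a time exhausts H(C).
module Submission where

open import Defs hiding (sym)
open import Data.Nat using (ℕ; zero; suc; _+_; _*_; _≤_; _<_; z≤n)
open import Data.Nat.Properties using (+-suc; +-comm; +-cancelˡ-≤; +-mono-≤; +-monoˡ-≤; ≤-<-trans; m<1+n⇒m≤n; module ≤-Reasoning)
open import Data.Bool using (Bool; true; false; _∧_; not)
open import Data.Bool.Properties using (¬-not)
open import Data.Fin using (Fin)
import Data.Fin as Fin
open import Data.Fin.Properties using (suc-injective; 0≢1+n)
open import Data.Fin.Subset using (Subset; _∈_; _∉_; _⊆_; _∩_; _∪_; ∣_∣; Nonempty; _-_)
open import Data.Fin.Subset.Properties
  using (_∈?_; p⊆q⇒∣p∣≤∣q∣; ⊆-antisym; p∩q⊆p; x∈p∩q⁺; x∈p∩q⁻; x∈p∪q⁺; x∈p∪q⁻; p⊆p∪q; q⊆p∪q;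
         x∈∁p⇒x∉p; x∉p⇒x∈∁p; x∈p∧x≢y⇒x∈p-y; x∈p⇒∣p-x∣<∣p∣)
open import Data.Vec using ([]; _∷_; lookup)
open import Data.Vec.Properties using (lookup∘tabulate; []=⇒lookup; lookup⇒[]=)
open import Data.List using ([]; _∷_; _++_; allFin)
import Data.List.Membership.Propositional as List
open import Data.List.Membership.Propositional.Properties using (∈-allFin)
open import Data.List.Relation.Unary.Any using (here; there)
open import Data.Product using (∃-syntax; _×_; _,_; proj₁; proj₂)
open import Data.Sum using (inj₁; inj₂)
open import Data.Empty using (⊥-elim)
open import Function using (_∘_)
open import Function.Bundles using (_⇔_; Equivalence)
open import Function.Definitions using (Injective)
open import Relation.Binary.PropositionalEquality using (_≡_; _≢_; refl; sym; trans; cong; cong₂; subst)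
open import Relation.Nullary using (yes; no; contradiction)

∧-true⁻ : ∀ {x y} → x ∧ y ≡ true → x ≡ true × y ≡ true
∧-true⁻ {true} y≡true = refl , y≡true

anyFin⁺ : ∀ {n} {f : Fin n → Bool} i → f i ≡ true → anyFin f ≡ true
anyFin⁺ Fin.zero fi≡true rewrite fi≡true = refl
anyFin⁺ {f = f} (Fin.suc i) fi≡true with f Fin.zero
... | true  = refl
... | false = anyFin⁺ i fi≡true

anyFin⁻ : ∀ {n} {f : Fin n → Bool} → anyFin f ≡ true → ∃[ i ] f i ≡ true
anyFin⁻ {suc _} {f} any≡true with f Fin.zero in f0≡
... | true  = Fin.zero , f0≡
... | false with anyFin⁻ any≡true
...   | i , fi≡true = Fin.suc i , fi≡true

m<n+1⇒m≤n : ∀ {m n} → m < n + 1 → m ≤ n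
m<n+1⇒m≤n {m} {n} = m<1+n⇒m≤n ∘ subst (m <_) (+-comm n 1)

∣p∪q∣+∣p∩q∣≡∣p∣+∣q∣ : ∀ {n} (p q : Subset n) → ∣ p ∪ q ∣ + ∣ p ∩ q ∣ ≡ ∣ p ∣ + ∣ q ∣
∣p∪q∣+∣p∩q∣≡∣p∣+∣q∣ []      []      = refl
∣p∪q∣+∣p∩q∣≡∣p∣+∣q∣ (true  ∷ p) (true  ∷ q) =
  cong suc (trans (+-suc ∣ p ∪ q ∣ ∣ p ∩ q ∣)
                  (trans (cong suc (∣p∪q∣+∣p∩q∣≡∣p∣+∣q∣ p q)) (sym (+-suc ∣ p ∣ ∣ q ∣))))
∣p∪q∣+∣p∩q∣≡∣p∣+∣q∣ (true  ∷ p) (false ∷ q) = cong suc (∣p∪q∣+∣p∩q∣≡∣p∣+∣q∣ p q)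
∣p∪q∣+∣p∩q∣≡∣p∣+∣q∣ (false ∷ p) (true  ∷ q) =
  trans (cong suc (∣p∪q∣+∣p∩q∣≡∣p∣+∣q∣ p q)) (sym (+-suc ∣ p ∣ ∣ q ∣))
∣p∪q∣+∣p∩q∣≡∣p∣+∣q∣ (false ∷ p) (false ∷ q) = ∣p∪q∣+∣p∩q∣≡∣p∣+∣q∣ p q

injective⇒≤∣p∣ : ∀ {n k} {p : Subset n} (f : Fin k → Fin n) →
                  Injective _≡_ _≡_ f → (∀ i → f i ∈ p) → k ≤ ∣ p ∣
injective⇒≤∣p∣ {k = zero}  f f-inj f∈p = z≤n
injective⇒≤∣p∣ {k = suc k} f f-inj f∈p =
  ≤-<-trans (injective⇒≤∣p∣ (f ∘ Fin.suc) (suc-injective ∘ f-inj) f∘suc∈p-f0) (x∈p⇒∣p-x∣<∣p∣ (f∈p Fin.zero))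
  where
  f∘suc∈p-f0 : ∀ i → f (Fin.suc i) ∈ _ - f Fin.zero
  f∘suc∈p-f0 i = x∈p∧x≢y⇒x∈p-y (f∈p (Fin.suc i)) (0≢1+n ∘ sym ∘ f-inj)

module _ {n : ℕ} (G : Graph n) where

  -- U* of the paper: Defs' postfix _* cannot be written here, as it clashes with multiplication.
  infix 8 _⋆
  _⋆ : Subset n → Subset n
  U ⋆ = (G *) U

  ∈N⁺ : ∀ {U u v} → u ∈ U → adj G u v ≡ true → v ∉ U → v ∈ N G U
  ∈N⁺ {U} {u} {v} u∈U uv v∉U = lookup⇒[]= v (N G U)
    (trans (lookup∘tabulate _ v)
           (cong₂ _∧_ (cong not (¬-not (v∉U ∘ lookup⇒[]= v U)))
                      (anyFin⁺ u (cong₂ _∧_ ([]=⇒lookup u∈U) uv))))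

  ∈N⁻ : ∀ {U v} → v ∈ N G U → v ∉ U × ∃[ u ] (u ∈ U × adj G u v ≡ true)
  ∈N⁻ {U} {v} v∈NU with ∧-true⁻ (trans (sym (lookup∘tabulate _ v)) ([]=⇒lookup v∈NU))
  ... | v∉U , adjacent with anyFin⁻ adjacent
  ...   | u , u∈U∧uv with ∧-true⁻ u∈U∧uv
  ...     | u∈U , uv = (λ v∈U → contradiction (trans (cong not (sym ([]=⇒lookup v∈U))) v∉U) λ ())
                     , u , lookup⇒[]= u U u∈U , uv

  ∈⋆⁻ : ∀ {U t} → t ∈ U ⋆ → t ∉ U × t ∉ N G U
  ∈⋆⁻ t∈U* = x∈∁p⇒x∉p t∈U* ∘ x∈p∪q⁺ ∘ inj₁ , x∈∁p⇒x∉p t∈U* ∘ x∈p∪q⁺ ∘ inj₂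

  ⋆-antitone : ∀ {U W} → U ⊆ W → W ⋆ ⊆ U ⋆
  ⋆-antitone {U} {W} U⊆W {t} t∈W* = x∉p⇒x∈∁p t∉U∪NU
    where
    t∉U∪NU : t ∉ U ∪ N G U
    t∉U∪NU t∈U∪NU with ∈⋆⁻ t∈W* | x∈p∪q⁻ U (N G U) t∈U∪NU
    ... | t∉W , _   | inj₁ t∈U  = t∉W (U⊆W t∈U)
    ... | t∉W , t∉NW | inj₂ t∈NU with ∈N⁻ t∈NU
    ...   | _ , u , u∈U , ut = t∉NW (∈N⁺ (U⊆W u∈U) ut t∉W)

  N[∩]∪N[∪]⊆N∪N : ∀ U W → N G (U ∩ W) ∪ N G (U ∪ W) ⊆ N G U ∪ N G W
  N[∩]∪N[∪]⊆N∪N U W {v} v∈ with x∈p∪q⁻ (N G (U ∩ W)) _ v∈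
  ... | inj₁ v∈N∩ with ∈N⁻ v∈N∩
  ...   | v∉U∩W , u , u∈U∩W , uv with x∈p∩q⁻ U W u∈U∩W | v ∈? U
  ...     | u∈U , u∈W | yes v∈U = q⊆p∪q _ _ (∈N⁺ u∈W uv (v∉U∩W ∘ x∈p∩q⁺ ∘ (v∈U ,_)))
  ...     | u∈U , u∈W | no v∉U  = p⊆p∪q _ (∈N⁺ u∈U uv v∉U)
  N[∩]∪N[∪]⊆N∪N U W {v} v∈ | inj₂ v∈N∪ with ∈N⁻ v∈N∪
  ...   | v∉U∪W , u , u∈U∪W , uv with x∈p∪q⁻ U W u∈U∪W
  ...     | inj₁ u∈U = p⊆p∪q _ (∈N⁺ u∈U uv (v∉U∪W ∘ p⊆p∪q W))
  ...     | inj₂ u∈W = q⊆p∪q _ _ (∈N⁺ u∈W uv (v∉U∪W ∘ q⊆p∪q U W))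

  N[∩]∩N[∪]⊆N∩N : ∀ U W → N G (U ∩ W) ∩ N G (U ∪ W) ⊆ N G U ∩ N G W
  N[∩]∩N[∪]⊆N∩N U W v∈ with x∈p∩q⁻ (N G (U ∩ W)) _ v∈
  ... | v∈N∩ , v∈N∪ with ∈N⁻ v∈N∩ | ∈N⁻ v∈N∪
  ...   | _ , u , u∈U∩W , uv | v∉U∪W , _ with x∈p∩q⁻ U W u∈U∩W
  ...     | u∈U , u∈W = x∈p∩q⁺ (∈N⁺ u∈U uv (v∉U∪W ∘ p⊆p∪q W) , ∈N⁺ u∈W uv (v∉U∪W ∘ q⊆p∪q U W))

  ∣N∣-submodular : ∀ U W → ∣ N G (U ∩ W) ∣ + ∣ N G (U ∪ W) ∣ ≤ ∣ N G U ∣ + ∣ N G W ∣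
  ∣N∣-submodular U W = begin
    ∣ A ∣ + ∣ B ∣                           ≡⟨ sym (∣p∪q∣+∣p∩q∣≡∣p∣+∣q∣ A B) ⟩
    ∣ A ∪ B ∣ + ∣ A ∩ B ∣                   ≤⟨ +-mono-≤ (p⊆q⇒∣p∣≤∣q∣ (N[∩]∪N[∪]⊆N∪N U W))
                                                     (p⊆q⇒∣p∣≤∣q∣ (N[∩]∩N[∪]⊆N∩N U W)) ⟩
    ∣ N G U ∪ N G W ∣ + ∣ N G U ∩ N G W ∣   ≡⟨ ∣p∪q∣+∣p∩q∣≡∣p∣+∣q∣ (N G U) (N G W) ⟩
    ∣ N G U ∣ + ∣ N G W ∣                   ∎
    where
    open ≤-Reasoning
    A = N G (U ∩ W)
    B = N G (U ∪ W)

  path-meets-N : ∀ {X a t} xs → Chain G (a ∷ xs ++ t ∷ []) → a ∈ X → t ∈ X ⋆ →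
                 ∃[ v ] (v List.∈ xs × v ∈ N G X)
  path-meets-N [] (chain-∷ _ _ _ at _) a∈X t∈X* with ∈⋆⁻ t∈X*
  ... | t∉X , t∉NX = contradiction (∈N⁺ a∈X at t∉X) t∉NX
  path-meets-N {X} (y ∷ ys) (chain-∷ _ _ _ ay chain) a∈X t∈X* with y ∈? X
  ... | no y∉X  = y , here refl , ∈N⁺ a∈X ay y∉X
  ... | yes y∈X with path-meets-N ys chain y∈X t∈X*
  ...   | v , v∈ys , v∈NX = v , there v∈ys , v∈NX

  disjoint-paths⇒≤∣N∣ : ∀ {k s t X} → OpenlyDisjointPaths G k s t → s ∈ X → t ∈ X ⋆ → k ≤ ∣ N G X ∣
  disjoint-paths⇒≤∣N∣ {X = X} (paths , disjoint) s∈X t∈X* =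
    injective⇒≤∣p∣ (proj₁ ∘ crossing) crossing-injective (proj₂ ∘ proj₂ ∘ crossing)
    where
    crossing : ∀ i → ∃[ v ] (v List.∈ inner (lookup paths i) × v ∈ N G X)
    crossing i = path-meets-N (inner (lookup paths i)) (chain (lookup paths i)) s∈X t∈X*

    crossing-injective : Injective _≡_ _≡_ (proj₁ ∘ crossing)
    crossing-injective {i} {j} vᵢ≡vⱼ with i Fin.≟ j
    ... | yes i≡j = i≡j
    ... | no  i≢j = ⊥-elim (disjoint i j i≢j _ (proj₁ (proj₂ (crossing i)))
                      (subst (List._∈ inner (lookup paths j)) (sym vᵢ≡vⱼ) (proj₁ (proj₂ (crossing j)))))

  Separating : Subset n → ℕ → Fin n → Subset n → Set
  Separating T ℓ s U = s ∈ U × Nonempty (U ⋆ ∩ T) × ∣ N G U ∣ ≤ ℓ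

  module _ {T : Subset n} {ℓ : ℕ} (connected : Connected G T ℓ) where

    ∪-preserves-∣N∣≤ : ∀ {s U W} → s ∈ T → Separating T ℓ s U → s ∈ W → ∣ N G W ∣ ≤ ℓ →
                       ∣ N G (U ∪ W) ∣ ≤ ℓ
    ∪-preserves-∣N∣≤ {s} {U} {W} s∈T (s∈U , (t , t∈U⋆∩T) , ∣NU∣≤ℓ) s∈W ∣NW∣≤ℓ =
      +-cancelˡ-≤ ℓ _ _ (begin
        ℓ + ∣ N G (U ∪ W) ∣                 ≤⟨ +-monoˡ-≤ _ ℓ≤∣N[U∩W]∣ ⟩
        ∣ N G (U ∩ W) ∣ + ∣ N G (U ∪ W) ∣   ≤⟨ ∣N∣-submodular U W ⟩
        ∣ N G U ∣ + ∣ N G W ∣               ≤⟨ +-mono-≤ ∣NU∣≤ℓ ∣NW∣≤ℓ ⟩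
        ℓ + ℓ                               ∎)
      where
      open ≤-Reasoning
      t∈U⋆ : t ∈ U ⋆
      t∈U⋆ = proj₁ (x∈p∩q⁻ (U ⋆) T t∈U⋆∩T)
      t∈T : t ∈ T
      t∈T = proj₂ (x∈p∩q⁻ (U ⋆) T t∈U⋆∩T)
      s≢t : s ≢ t
      s≢t refl = proj₁ (∈⋆⁻ t∈U⋆) s∈U
      ℓ≤∣N[U∩W]∣ : ℓ ≤ ∣ N G (U ∩ W) ∣
      ℓ≤∣N[U∩W]∣ = disjoint-paths⇒≤∣N∣ (connected s t s∈T t∈T s≢t)
                     (x∈p∩q⁺ (s∈U , s∈W)) (⋆-antitone (p∩q⊆p U W) t∈U⋆)

    ⋃-∣N∣≤ : (F : Subset n → Set) {s : Fin n} → s ∈ T →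
             (∀ {U} → F U → Separating T ℓ s U) →
             ∀ {C H} → F C → (∀ v → (v ∈ H) ⇔ (∃[ U ] (F U × v ∈ U))) → ∣ N G H ∣ ≤ ℓ
    ⋃-∣N∣≤ F {s} s∈T separating {C} {H} C∈F H≡⋃F with cover (allFin n)
      where
      member⊆H : ∀ {U} → F U → U ⊆ H
      member⊆H U∈F u∈U = Equivalence.from (H≡⋃F _) (_ , U∈F , u∈U)

      ∪⊆H : ∀ {U W} → F U → W ⊆ H → U ∪ W ⊆ H
      ∪⊆H {U} {W} U∈F W⊆H x∈U∪W with x∈p∪q⁻ U W x∈U∪W
      ... | inj₁ x∈U = member⊆H U∈F x∈U
      ... | inj₂ x∈W = W⊆H x∈W

      cover : ∀ vs → ∃[ W ] (W ⊆ H × s ∈ W × ∣ N G W ∣ ≤ ℓ × (∀ {v} → v List.∈ vs → v ∈ H → v ∈ W))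
      cover [] = C , member⊆H C∈F , proj₁ (separating C∈F) , proj₂ (proj₂ (separating C∈F)) , λ ()
      cover (v ∷ vs) with cover vs | v ∈? H
      ... | W , W⊆H , s∈W , ∣NW∣≤ℓ , covers | no v∉H =
        W , W⊆H , s∈W , ∣NW∣≤ℓ , λ { (here refl) v∈H → contradiction v∈H v∉H ; (there w∈vs) → covers w∈vs }
      ... | W , W⊆H , s∈W , ∣NW∣≤ℓ , covers | yes v∈H with Equivalence.to (H≡⋃F v) v∈H
      ...   | U , U∈F , v∈U =
        U ∪ W , ∪⊆H U∈F W⊆H , q⊆p∪q U W s∈W , ∪-preserves-∣N∣≤ s∈T (separating U∈F) s∈W ∣NW∣≤ℓ ,
        λ { (here refl) _ → p⊆p∪q W v∈U ; (there w∈vs) w∈H → q⊆p∪q U W (covers w∈vs w∈H) }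
    ... | W , W⊆H , _ , ∣NW∣≤ℓ , covers =
      subst (λ X → ∣ N G X ∣ ≤ ℓ) (⊆-antisym W⊆H (λ {v} → covers (∈-allFin v))) ∣NW∣≤ℓ

lemma13 : (n : ℕ) (G : Graph n) (T : Subset n) (ℓ : ℕ)
            → Connected G T ℓ
            → 2 * ℓ ≤ ∣ T ∣
            → (∀ s t → s ∈ T → t ∈ T → adj G s t ≡ false)
            → (C : Subset n) → Core G T ℓ C
            → (H : Subset n) → IsHaloSet G T ℓ C H
            → ∣ N G H ∣ ≤ ℓ
lemma13 n G T ℓ connected _ _ C (C-small@(deficient , _) , minimal) H isHaloSet =
  ⋃-∣N∣≤ G connected (InHalo G T ℓ C) s∈T halo-member-separated C∈Halo isHaloSet
  where
  s : Fin n
  s = proj₁ (proj₁ deficient)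
  s∈C : s ∈ C
  s∈C = proj₁ (x∈p∩q⁻ C T (proj₂ (proj₁ deficient)))
  s∈T : s ∈ T
  s∈T = proj₂ (x∈p∩q⁻ C T (proj₂ (proj₁ deficient)))

  halo-member-separated : ∀ {U} → InHalo G T ℓ C U → Separating G T ℓ s U
  halo-member-separated (((_ , t∈U* , ∣NU∣<ℓ+1) , _) , C⊆U , _) = C⊆U s∈C , t∈U* , m<n+1⇒m≤n ∣NU∣<ℓ+1

  C∈Halo : InHalo G T ℓ C C
  C∈Halo = C-small , (λ x∈C → x∈C) , λ D D-core D⊆C → minimal D (proj₁ D-core) D⊆C
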